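{- Let $K$ be a quadratic field with fundamental discriminant $D_K$, $f\ge1$, $D=f^2D_K$, and let $(\delta_1,\delta_2)$ be a reciprocal pair of fundamental divisors of $D$ with $\delta_1\delta_2=f_1^2D_K$, $f_1\mid f$, $f_0=f/f_1$. Let $p$ be a prime with $p\mid f$, $e=\mathrm{ord}_p(f)$, $m_p=\mathrm{ord}_p(f_0)$, $\phi=\chi_{\delta_1}$, $\psi=\chi_{\delta_2}$. (1) If $m_p<e$, then $\phi(p)=\psi(p)=0$. (2) If $\phi(p)=\psi(p)=0$ and $p\nmid D_K$, then $m_p<e$.
   Context: A fundamental divisor of $D$ is an integer $\delta\mid D$ which is $1$ or the discriminant of a quadratic field, with $D/\delta\equiv0$ or $1\pmod4$; fundamental divisors $\delta_1,\delta_2$ are reciprocal if $\delta_1\delta_2=f_1^2D_K$ for some positive divisor $f_1$ of $f$. $\chi_\delta(n)=\left(\frac{\delta}{n}\right)$ is the Kronecker symbol, with $\chi_\delta(p)=0$ iff $p\mid\delta$, and $\chi_1$ trivial. -}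

module Defs where

open import Data.Bool using (Bool; true; false; if_then_else_; _∨_)
open import Data.Nat as ℕ using (ℕ; zero; suc; _≡ᵇ_)
open import Data.Nat.DivMod using (_%_)
open import Data.List using (upTo)
open import Data.Bool.ListAction using (any)
open import Data.Integer using (ℤ; +_; -_; _*_; ∣_∣; 0ℤ; 1ℤ)
open import Data.Integer.DivMod using (_%ℕ_)
open import Data.Integer.Divisibility using (_∣_)
open import Data.Nat.Primality using (Prime)
open import Data.Product using (_×_; ∃; Σ)
open import Data.Sum using (_⊎_)
open import Relation.Binary.PropositionalEquality using (_≡_; _≢_)
open import Relation.Nullary using (¬_)

SquareFree : ℤ → Set
SquareFree n = ∀ (k : ℕ) → (+ k * + k) ∣ n → k ≡ 1

FundDisc : ℤ → Set
FundDisc d =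
  (d %ℕ 4 ≡ 1 × d ≢ 1ℤ × SquareFree d)
  ⊎ (∃ λ (m : ℤ) → d ≡ + 4 * m × (m %ℕ 4 ≡ 2 ⊎ m %ℕ 4 ≡ 3) × SquareFree m)

FundDivisor : ℤ → ℤ → Set
FundDivisor D δ =
  (δ ≡ 1ℤ ⊎ FundDisc δ)
  × ∃ λ (q : ℤ) → D ≡ δ * q × (q %ℕ 4 ≡ 0 ⊎ q %ℕ 4 ≡ 1)

Ord : ℕ → ℕ → ℕ → Set
Ord p n e = (p ℕ.^ e) Data.Nat.Divisibility.∣ n × ¬ ((p ℕ.^ suc e) Data.Nat.Divisibility.∣ n)
  where import Data.Nat.Divisibility

-- Kronecker symbol (δ / p) evaluated at a prime p (only used for primes p).
--   p ∣ δ                  : 0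
--   p = 2, δ ≡ ±1 (mod 8)  : 1,   p = 2, δ ≡ ±3 (mod 8) : -1
--   p odd                  : Legendre symbol: 1 if δ is a square mod p, else -1
kronecker : ℤ → ℕ → ℤ
kronecker δ zero = 0ℤ
kronecker δ p@(suc p') =
  if (∣ δ ∣ % p) ≡ᵇ 0 then 0ℤ
  else if p ≡ᵇ 2
    then (if (δ %ℕ 8 ≡ᵇ 1) ∨ (δ %ℕ 8 ≡ᵇ 7) then 1ℤ else - 1ℤ)
    else (if any (λ x → ((x ℕ.* x) % p) ≡ᵇ (δ %ℕ p)) (upTo p) then 1ℤ else - 1ℤ)

{-# OPTIONS --safe #-}
module Submission where

-- Write f = f₁ f₀. Then ord_p f₀ < ord_p f says exactly that p ∣ f₁, and χ_δ(p) = 0 says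
-- p ∣ δ. If p ∣ f₁ then p² ∣ f₁² D_K = δ₁ δ₂. For odd p, neither δᵢ is divisible by p²
-- (each is 1, squarefree, or 4 times a squarefree number), so p divides both. For p = 2,
-- an odd δᵢ is ≡ 1 (mod 4); the other factor cannot be odd too (the product is ≡ 0 mod 4),
-- so it is 4m with m ≡ 2, 3 (mod 4), while δᵢ m = (f₁/2)² D_K ≡ 0, 1 (mod 4).
-- Conversely, if p ∣ δ₁ and p ∤ D_K, then p ∣ f₁² D_K gives p ∣ f₁.

open import Defs
open import Data.Nat using (ℕ; _<_; _≥_; _^_)
import Data.Nat
import Data.Integer.Divisibility
open import Data.Nat.Divisibility using (_∣_)
open import Data.Nat.Primality using (Prime)
open import Data.Integer using (ℤ; +_; _*_; 0ℤ)
open import Data.Product using (_×_)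
open import Relation.Binary.PropositionalEquality using (_≡_)
open import Relation.Nullary using (¬_)

open import Data.Nat as ℕ using (zero; suc; _≤_; z≤n; s≤s; _<?_)
open import Data.Nat.Properties as ℕₚ using ()
open import Data.Nat.Divisibility
  using (divides; _∣?_; ∣-trans; 1∣_; m∣m*n; ∣1⇒≡1; ∣⇒≤; *-pres-∣; *-monoʳ-∣; *-cancelˡ-∣;
         n∣m⇒m%n≡0; m%n≡0⇒n∣m)
open import Data.Nat.DivMod using (_%_; [m+kn]%n≡m%n)
open import Data.Nat.Primality using (euclidsLemma; ¬prime[0]; ¬prime[1]; prime⇒nonZero; prime⇒nonTrivial)
open import Data.Integer using (-_; -[1+_]; _+_; _-_; ∣_∣; 1ℤ)
open import Data.Integer.Properties as ℤₚ using (pos-+; pos-*; abs-*)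
open import Data.Integer.DivMod using (_%ℕ_; _/ℕ_; n%ℕd<d; a≡a%ℕn+[a/ℕn]*n)
open import Data.Integer.Tactic.RingSolver using (solve-∀)
open import Data.Bool using (true; false; if_then_else_)
open import Data.Product as Product using (_,_; ∃)
open import Data.Sum as Sum using (_⊎_; inj₁; inj₂)
open import Data.Empty using (⊥-elim)
open import Function using (case_of_)
open import Relation.Binary.PropositionalEquality using (_≢_; refl; sym; trans; cong; subst; module ≡-Reasoning)
open import Relation.Nullary using (yes; no)

open ≡-Reasoning

m^2≡m*m : ∀ m → m ^ 2 ≡ m ℕ.* m
m^2≡m*m m = cong (m ℕ.*_) (ℕₚ.*-identityʳ m)

abs-*-≡ : ∀ a b c d → a * b ≡ c * d → ∣ a ∣ ℕ.* ∣ b ∣ ≡ ∣ c ∣ ℕ.* ∣ d ∣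
abs-*-≡ a b c d eq = trans (sym (abs-* a b)) (trans (cong ∣_∣ eq) (abs-* c d))

pos-^2 : ∀ n → + (n ^ 2) ≡ + n * + n
pos-^2 n = trans (cong +_ (m^2≡m*m n)) (pos-* n n)

^-monoʳ-∣ : ∀ p {m n} → m ≤ n → p ^ m ∣ p ^ n
^-monoʳ-∣ p {n = n} z≤n     = 1∣ (p ^ n)
^-monoʳ-∣ p         (s≤s m≤n) = *-monoʳ-∣ p (^-monoʳ-∣ p m≤n)

prime∣^⇒∣ : ∀ {p n} → Prime p → ∀ k → p ∣ n ^ k → p ∣ n
prime∣^⇒∣ pp zero    p∣1 = ⊥-elim (¬prime[1] (subst Prime (∣1⇒≡1 p∣1) pp))
prime∣^⇒∣ {n = n} pp (suc k) p∣nᵏ⁺¹ with euclidsLemma n (n ^ k) pp p∣nᵏ⁺¹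
... | inj₁ p∣n  = p∣n
... | inj₂ p∣nᵏ = prime∣^⇒∣ pp k p∣nᵏ

prime∣2⇒≡2 : ∀ {p} → Prime p → p ∣ 2 → p ≡ 2
prime∣2⇒≡2 {p} pp p∣2 = ℕₚ.≤-antisym (∣⇒≤ p∣2) (ℕ.nonTrivial⇒n>1 p {{prime⇒nonTrivial pp}})

prime^k∣m*n∧p∤m⇒p^k∣n : ∀ {p m n} → Prime p → ¬ p ∣ m → ∀ k → p ^ k ∣ m ℕ.* n → p ^ k ∣ n
prime^k∣m*n∧p∤m⇒p^k∣n {n = n} pp p∤m zero _ = 1∣ n
prime^k∣m*n∧p∤m⇒p^k∣n {p} {m} pp p∤m (suc k) pᵏ⁺¹∣mn
  with euclidsLemma m _ pp (∣-trans (m∣m*n (p ^ k)) pᵏ⁺¹∣mn)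
... | inj₁ p∣m = ⊥-elim (p∤m p∣m)
... | inj₂ (divides c refl) = subst (p ^ suc k ∣_) (ℕₚ.*-comm p c) (*-monoʳ-∣ p pᵏ∣c)
  where
  instance _ = prime⇒nonZero pp
  pᵏ∣c : p ^ k ∣ c
  pᵏ∣c = prime^k∣m*n∧p∤m⇒p^k∣n pp p∤m k (*-cancelˡ-∣ p
    (subst (p ^ suc k ∣_) (trans (sym (ℕₚ.*-assoc m c p)) (ℕₚ.*-comm (m ℕ.* c) p)) pᵏ⁺¹∣mn))

prime²∣m*n⇒∣both : ∀ {p m n} → Prime p → ¬ p ^ 2 ∣ m → ¬ p ^ 2 ∣ n → p ^ 2 ∣ m ℕ.* n → (p ∣ m) × (p ∣ n)
prime²∣m*n⇒∣both {p} {m} {n} pp p²∤m p²∤n p²∣mn =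
  divides-left p²∤n p²∣mn , divides-left p²∤m (subst (p ^ 2 ∣_) (ℕₚ.*-comm m n) p²∣mn)
  where
  divides-left : ∀ {x y} → ¬ p ^ 2 ∣ y → p ^ 2 ∣ x ℕ.* y → p ∣ x
  divides-left {x} p²∤y p²∣xy with p ∣? x
  ... | yes p∣x = p∣x
  ... | no  p∤x = ⊥-elim (p²∤y (prime^k∣m*n∧p∤m⇒p^k∣n pp p∤x 2 p²∣xy))

∣⇒kronecker≡0 : ∀ δ p → p ∣ ∣ δ ∣ → kronecker δ p ≡ 0ℤ
∣⇒kronecker≡0 δ zero    _   = refl
∣⇒kronecker≡0 δ (suc p) p∣δ rewrite n∣m⇒m%n≡0 ∣ δ ∣ (suc p) p∣δ = refl

kronecker≡0⇒∣ : ∀ δ {p} → Prime p → kronecker δ p ≡ 0ℤ → p ∣ ∣ δ ∣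
kronecker≡0⇒∣ δ {zero}  pp _ = ⊥-elim (¬prime[0] pp)
kronecker≡0⇒∣ δ {suc p} _  χ≡0 with ∣ δ ∣ % suc p in eq
... | zero  = m%n≡0⇒n∣m ∣ δ ∣ (suc p) eq
... | suc _ = ⊥-elim (±1≢0 (p ℕ.≡ᵇ 1) _ _ χ≡0)
  where
  ±1≢0 : ∀ c b b′ → (if c then (if b then 1ℤ else - 1ℤ) else (if b′ then 1ℤ else - 1ℤ)) ≢ 0ℤ
  ±1≢0 true  true  _     ()
  ±1≢0 true  false _     ()
  ±1≢0 false _     true  ()
  ±1≢0 false _     false ()

ord<⇒∣ : ∀ {p m n e v} → Prime p → Ord p (m ℕ.* n) e → Ord p n v → v < e → p ∣ m
ord<⇒∣ {p} {m} {e = e} pp (pᵉ∣mn , _) (_ , pᵛ⁺¹∤n) v<e with p ∣? m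
... | yes p∣m = p∣m
... | no  p∤m = ⊥-elim (pᵛ⁺¹∤n (∣-trans (^-monoʳ-∣ p v<e) (prime^k∣m*n∧p∤m⇒p^k∣n pp p∤m e pᵉ∣mn)))

∣⇒ord< : ∀ {p m n e v} → Ord p (m ℕ.* n) e → Ord p n v → p ∣ m → v < e
∣⇒ord< {p} {e = e} {v} (_ , pᵉ⁺¹∤mn) (pᵛ∣n , _) p∣m with v <? e
... | yes v<e = v<e
... | no  v≮e = ⊥-elim (pᵉ⁺¹∤mn (∣-trans (^-monoʳ-∣ p (s≤s (ℕₚ.≮⇒≥ v≮e))) (*-pres-∣ p∣m pᵛ∣n)))

infix 4 _≡_mod4

_≡_mod4 : ℤ → ℕ → Set
x ≡ r mod4 = ∃ λ q → x ≡ + r + q * + 4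

≡%ℕ4-mod4 : ∀ x → x ≡ x %ℕ 4 mod4
≡%ℕ4-mod4 x = x /ℕ 4 , a≡a%ℕn+[a/ℕn]*n x 4

%ℕ4≡⇒mod4 : ∀ {x r} → x %ℕ 4 ≡ r → x ≡ r mod4
%ℕ4≡⇒mod4 {x} refl = ≡%ℕ4-mod4 x

4*-mod4 : ∀ x → + 4 * x ≡ 0 mod4
4*-mod4 x = x , trans (ℤₚ.*-comm (+ 4) x) (sym (ℤₚ.+-identityˡ (x * + 4)))

*-mod4 : ∀ {x y r s} → x ≡ r mod4 → y ≡ s mod4 → x * y ≡ r ℕ.* s mod4
*-mod4 {r = r} {s} (q , refl) (q′ , refl) = + r * q′ + q * + s + q * q′ * + 4 , (begin
  (+ r + q * + 4) * (+ s + q′ * + 4)            ≡⟨ expand (+ r) (+ s) q q′ ⟩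
  + r * + s + (+ r * q′ + q * + s + q * q′ * + 4) * + 4
    ≡⟨ cong (_+ (+ r * q′ + q * + s + q * q′ * + 4) * + 4) (sym (pos-* r s)) ⟩
  + (r ℕ.* s) + (+ r * q′ + q * + s + q * q′ * + 4) * + 4 ∎)
  where
  expand : ∀ a b q q′ → (a + q * + 4) * (b + q′ * + 4) ≡ a * b + (a * q′ + q * b + q * q′ * + 4) * + 4
  expand = solve-∀

pos-+-*4 : ∀ r k → + (r ℕ.+ k ℕ.* 4) ≡ + r + + k * + 4
pos-+-*4 r k = trans (pos-+ r (k ℕ.* 4)) (cong (λ z → + r + z) (pos-* k 4))

mod4-reduce : ∀ {x r} k → x ≡ r ℕ.+ k ℕ.* 4 mod4 → x ≡ r mod4
mod4-reduce {r = r} k (q , refl) = + k + q , (begin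
  + (r ℕ.+ k ℕ.* 4) + q * + 4    ≡⟨ cong (_+ q * + 4) (pos-+-*4 r k) ⟩
  + r + + k * + 4 + q * + 4      ≡⟨ regroup (+ r) (+ k) q ⟩
  + r + (+ k + q) * + 4          ∎)
  where
  regroup : ∀ a k q → a + k * + 4 + q * + 4 ≡ a + (k + q) * + 4
  regroup = solve-∀

mod4-unique : ∀ {x r s} → x ≡ r mod4 → x ≡ s mod4 → r % 4 ≡ s % 4
mod4-unique {r = r} {s} (q , refl) (q′ , eq) = shifted r s (q - q′) (begin
  + r + (q - q′) * + 4               ≡⟨ regroup (+ r) q q′ ⟩
  (+ r + q * + 4) - q′ * + 4         ≡⟨ cong (_- q′ * + 4) eq ⟩
  (+ s + q′ * + 4) - q′ * + 4        ≡⟨ cancel (+ s) q′ ⟩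
  + s                                ∎)
  where
  regroup : ∀ a q q′ → a + (q - q′) * + 4 ≡ (a + q * + 4) - q′ * + 4
  regroup = solve-∀

  cancel : ∀ a q → (a + q * + 4) - q * + 4 ≡ a
  cancel = solve-∀

  shifted-pos : ∀ a b k → + a + + k * + 4 ≡ + b → a % 4 ≡ b % 4
  shifted-pos a b k eq = trans (sym ([m+kn]%n≡m%n a k 4)) (cong (_% 4) (ℤₚ.+-injective (begin
    + (a ℕ.+ k ℕ.* 4)   ≡⟨ pos-+-*4 a k ⟩
    + a + + k * + 4     ≡⟨ eq ⟩
    + b                 ∎)))

  shifted : ∀ a b q → + a + q * + 4 ≡ + b → a % 4 ≡ b % 4
  shifted a b (+ k)    eq = shifted-pos a b k eq
  shifted a b -[1+ k ] eq = sym (shifted-pos b a (suc k) (begin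
    + b + + suc k * + 4                  ≡⟨ cong (λ z → z + + suc k * + 4) eq ⟨
    + a + -[1+ k ] * + 4 + + suc k * + 4 ≡⟨ cancel (+ a) -[1+ k ] ⟩
    + a                                  ∎))

DiscResidue : ℤ → Set
DiscResidue x = x ≡ 0 mod4 ⊎ x ≡ 1 mod4

*-discResidue : ∀ {x y} → DiscResidue x → DiscResidue y → DiscResidue (x * y)
*-discResidue (inj₁ x≡0) (inj₁ y≡0) = inj₁ (*-mod4 x≡0 y≡0)
*-discResidue (inj₁ x≡0) (inj₂ y≡1) = inj₁ (*-mod4 x≡0 y≡1)
*-discResidue (inj₂ x≡1) (inj₁ y≡0) = inj₁ (*-mod4 x≡1 y≡0)
*-discResidue (inj₂ x≡1) (inj₂ y≡1) = inj₂ (*-mod4 x≡1 y≡1)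

square-discResidue : ∀ x → DiscResidue (x * x)
square-discResidue x = go (x %ℕ 4) (n%ℕd<d x 4) (≡%ℕ4-mod4 x)
  where
  go : ∀ r → r < 4 → x ≡ r mod4 → DiscResidue (x * x)
  go 0 _ x≡r = inj₁ (*-mod4 x≡r x≡r)
  go 1 _ x≡r = inj₂ (*-mod4 x≡r x≡r)
  go 2 _ x≡r = inj₁ (mod4-reduce 1 (*-mod4 x≡r x≡r))
  go 3 _ x≡r = inj₂ (mod4-reduce 2 (*-mod4 x≡r x≡r))
  go (suc (suc (suc (suc _)))) (s≤s (s≤s (s≤s (s≤s ()))))

¬discResidue : ∀ {x} → x ≡ 2 mod4 ⊎ x ≡ 3 mod4 → ¬ DiscResidue x
¬discResidue (inj₁ x≡2) (inj₁ x≡0) = case mod4-unique x≡2 x≡0 of λ ()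
¬discResidue (inj₁ x≡2) (inj₂ x≡1) = case mod4-unique x≡2 x≡1 of λ ()
¬discResidue (inj₂ x≡3) (inj₁ x≡0) = case mod4-unique x≡3 x≡0 of λ ()
¬discResidue (inj₂ x≡3) (inj₂ x≡1) = case mod4-unique x≡3 x≡1 of λ ()

DiscOrOne : ℤ → Set
DiscOrOne δ = δ ≡ 1ℤ ⊎ FundDisc δ

fundDisc-discResidue : ∀ {d} → FundDisc d → DiscResidue d
fundDisc-discResidue (inj₁ (d%4≡1 , _))   = inj₂ (%ℕ4≡⇒mod4 d%4≡1)
fundDisc-discResidue (inj₂ (m , refl , _)) = inj₁ (4*-mod4 m)

discOrOne-mod4 : ∀ {δ} → DiscOrOne δ → δ ≡ 1 mod4 ⊎ ∃ λ m → δ ≡ + 4 * m × (m ≡ 2 mod4 ⊎ m ≡ 3 mod4)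
discOrOne-mod4 (inj₁ refl)                        = inj₁ (0ℤ , refl)
discOrOne-mod4 (inj₂ (inj₁ (δ%4≡1 , _)))          = inj₁ (%ℕ4≡⇒mod4 δ%4≡1)
discOrOne-mod4 (inj₂ (inj₂ (m , refl , m%4 , _))) = inj₂ (m , refl , Sum.map %ℕ4≡⇒mod4 %ℕ4≡⇒mod4 m%4)

discOrOne-even : ∀ {δ δ′ X} → DiscOrOne δ → DiscOrOne δ′ → DiscResidue X → δ * δ′ ≡ + 4 * X → 2 ∣ ∣ δ ∣
discOrOne-even {δ} {δ′} {X} d d′ X-res eq with discOrOne-mod4 d | discOrOne-mod4 d′
... | inj₂ (m , refl , _) | _ = subst (2 ∣_) (sym (abs-* (+ 4) m)) (∣-trans (divides 2 refl) (m∣m*n ∣ m ∣))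
... | inj₁ δ≡1 | inj₁ δ′≡1 =
  case mod4-unique (*-mod4 δ≡1 δ′≡1) (subst (λ z → z ≡ 0 mod4) (sym eq) (4*-mod4 X)) of λ ()
... | inj₁ δ≡1 | inj₂ (m , refl , m≡2∨3) =
  ⊥-elim (¬discResidue (Sum.map (*-mod4 δ≡1) (*-mod4 δ≡1) m≡2∨3) (subst DiscResidue (sym δm≡X) X-res))
  where
  δm≡X : δ * m ≡ X
  δm≡X = ℤₚ.*-cancelˡ-≡ (+ 4) _ _ (trans (swap δ m) eq)
    where
    swap : ∀ a b → + 4 * (a * b) ≡ a * (+ 4 * b)
    swap = solve-∀

squareFree-p²∤ : ∀ {p d} → Prime p → SquareFree d → ¬ p ^ 2 ∣ ∣ d ∣
squareFree-p²∤ {p} {d} pp sf p²∣d =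
  ¬prime[1] (subst Prime (sf p (subst (_∣ ∣ d ∣) (trans (m^2≡m*m p) (sym (abs-* (+ p) (+ p)))) p²∣d)) pp)

discOrOne-p²∤ : ∀ {p δ} → Prime p → p ≢ 2 → DiscOrOne δ → ¬ p ^ 2 ∣ ∣ δ ∣
discOrOne-p²∤ {p} pp _ (inj₁ refl) p²∣1 = ¬prime[1] (subst Prime (∣1⇒≡1 (∣-trans (m∣m*n (p ^ 1)) p²∣1)) pp)
discOrOne-p²∤ {δ = δ} pp _ (inj₂ (inj₁ (_ , _ , sf))) = squareFree-p²∤ {d = δ} pp sf
discOrOne-p²∤ {p} pp p≢2 (inj₂ (inj₂ (m , refl , _ , sf))) p²∣4m =
  squareFree-p²∤ {d = m} pp sf (prime^k∣m*n∧p∤m⇒p^k∣n pp p∤4 2 (subst (p ^ 2 ∣_) (abs-* (+ 4) m) p²∣4m))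
  where
  p∤4 : ¬ p ∣ 4
  p∤4 p∣4 = p≢2 (prime∣2⇒≡2 pp (prime∣^⇒∣ {n = 2} pp 2 p∣4))

prime∣conductor⇒prime∣δs : ∀ {DK δ₁ δ₂ f₁ p} → FundDisc DK → DiscOrOne δ₁ → DiscOrOne δ₂ →
  δ₁ * δ₂ ≡ + (f₁ ^ 2) * DK → Prime p → p ∣ f₁ → (p ∣ ∣ δ₁ ∣) × (p ∣ ∣ δ₂ ∣)
prime∣conductor⇒prime∣δs {DK} {δ₁} {δ₂} {f₁} {p} fdK d₁ d₂ eq pp p∣f₁ with p ℕ.≟ 2 | p∣f₁
... | yes refl | divides h refl =
  discOrOne-even d₁ d₂ X-res eq′ , discOrOne-even d₂ d₁ X-res (trans (ℤₚ.*-comm δ₂ δ₁) eq′)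
  where
  X-res : DiscResidue (+ h * + h * DK)
  X-res = *-discResidue (square-discResidue (+ h)) (fundDisc-discResidue fdK)

  halve : ∀ a d → a * + 2 * (a * + 2) * d ≡ + 4 * (a * a * d)
  halve = solve-∀

  eq′ : δ₁ * δ₂ ≡ + 4 * (+ h * + h * DK)
  eq′ = begin
    δ₁ * δ₂                             ≡⟨ eq ⟩
    + ((h ℕ.* 2) ^ 2) * DK              ≡⟨ cong (_* DK) (trans (pos-^2 (h ℕ.* 2)) (cong (λ z → z * z) (pos-* h 2))) ⟩
    + h * + 2 * (+ h * + 2) * DK        ≡⟨ halve (+ h) DK ⟩
    + 4 * (+ h * + h * DK)              ∎
... | no p≢2 | _ = prime²∣m*n⇒∣both pp (discOrOne-p²∤ pp p≢2 d₁) (discOrOne-p²∤ pp p≢2 d₂) p²∣δ₁δ₂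
  where
  p²∣δ₁δ₂ : p ^ 2 ∣ ∣ δ₁ ∣ ℕ.* ∣ δ₂ ∣
  p²∣δ₁δ₂ = subst (p ^ 2 ∣_) (sym (abs-*-≡ δ₁ δ₂ (+ (f₁ ^ 2)) DK eq))
    (∣-trans (*-pres-∣ p∣f₁ (*-pres-∣ p∣f₁ (1∣ 1))) (m∣m*n ∣ DK ∣))

prime∣δ⇒prime∣conductor : ∀ {DK δ₁ δ₂ f₁ p} → Prime p → ¬ p ∣ ∣ DK ∣ →
  δ₁ * δ₂ ≡ + (f₁ ^ 2) * DK → p ∣ ∣ δ₁ ∣ → p ∣ f₁
prime∣δ⇒prime∣conductor {DK} {δ₁} {δ₂} {f₁} {p} pp p∤DK eq p∣δ₁
  with euclidsLemma (f₁ ^ 2) ∣ DK ∣ pp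
         (subst (p ∣_) (abs-*-≡ δ₁ δ₂ (+ (f₁ ^ 2)) DK eq) (∣-trans p∣δ₁ (m∣m*n ∣ δ₂ ∣)))
... | inj₁ p∣f₁² = prime∣^⇒∣ pp 2 p∣f₁²
... | inj₂ p∣DK  = ⊥-elim (p∤DK p∣DK)

lemma4p4 : (DK : ℤ) → FundDisc DK →
    (f : ℕ) → f ≥ 1 → (D : ℤ) → D ≡ + (f ^ 2) * DK →
    (δ₁ δ₂ : ℤ) → FundDivisor D δ₁ → FundDivisor D δ₂ →
    (f₁ : ℕ) → f₁ ≥ 1 → f₁ ∣ f → δ₁ * δ₂ ≡ + (f₁ ^ 2) * DK →
    (f₀ : ℕ) → f ≡ f₁ Data.Nat.* f₀ →
    (p : ℕ) → Prime p → p ∣ f →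
    (e mₚ : ℕ) → Ord p f e → Ord p f₀ mₚ →
    (mₚ < e → kronecker δ₁ p ≡ 0ℤ × kronecker δ₂ p ≡ 0ℤ)
    × (kronecker δ₁ p ≡ 0ℤ → kronecker δ₂ p ≡ 0ℤ → ¬ (+ p Data.Integer.Divisibility.∣ DK) → mₚ < e)
lemma4p4 DK fdK _ _ _ _ δ₁ δ₂ (d₁ , _) (d₂ , _) f₁ _ _ eq f₀ refl p pp _ e mₚ ord-f ord-f₀ =
  vanish , converse
  where
  vanish : mₚ < e → kronecker δ₁ p ≡ 0ℤ × kronecker δ₂ p ≡ 0ℤ
  vanish mₚ<e = Product.map (∣⇒kronecker≡0 δ₁ p) (∣⇒kronecker≡0 δ₂ p)
    (prime∣conductor⇒prime∣δs {f₁ = f₁} fdK d₁ d₂ eq pp (ord<⇒∣ pp ord-f ord-f₀ mₚ<e))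

  converse : kronecker δ₁ p ≡ 0ℤ → kronecker δ₂ p ≡ 0ℤ → ¬ (+ p Data.Integer.Divisibility.∣ DK) → mₚ < e
  -- Only φ(p) = 0 is needed: p ∣ δ₁ ∣ f₁² D_K and p ∤ D_K already force p ∣ f₁.
  converse φ[p]≡0 _ p∤DK =
    ∣⇒ord< ord-f ord-f₀
      (prime∣δ⇒prime∣conductor {δ₁ = δ₁} {δ₂} {f₁} pp p∤DK eq (kronecker≡0⇒∣ δ₁ pp φ[p]≡0))
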